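{- Let $m\ge2$. (i) If $A$ is a string of length $2m$ whose autocorrelation (as a $2m$-bit string) has last $m$ bits $00\dots01$, then its autocorrelation is $10\dots01$, i.e. $C(A,A)=2^{2m-1}+1$. (ii) If $A$ is a string of length $2m+1$ whose autocorrelation has last $m$ bits $00\dots01$, then its autocorrelation is either $10\dots01$ (i.e. $2^{2m}+1$) or $1\underbrace{0\dots0}_{m-1}1\underbrace{0\dots0}_{m-1}1$ (i.e. $2^{2m}+2^m+1$). (iii) If $A$ is a string of length $2m+2$ whose autocorrelation has last $m$ bits $00\dots01$, then its autocorrelation is either $10\dots01$ (i.e. $2^{2m+1}+1$) or $1\underbrace{0\dots0}_{m}1\underbrace{0\dots0}_{m-1}1$ (i.e. $2^{2m+1}+2^m+1$).
   Context: Strings are finite strings over $\{H,T\}$. For strings $A=a_1\dots a_n$, $B=b_1\dots b_n$ of the same length $n$, the Conway number is $C(A,B)=\sum_{i=1}^n\delta_i2^{n-i}$, where $\delta_i=1$ if the last $n-i+1$ letters of $A$ equal the first $n-i+1$ letters of $B$ (i.e. $a_{i+j}=b_{1+j}$ for $j=0,\dots,n-i$), and $\delta_i=0$ otherwise. The autocorrelation of $A$ is $C(A,A)$, regarded as the $n$-bit string $\delta_1\delta_2\dots\delta_n$. -}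

module Defs where

open import Data.Nat using (ℕ; zero; suc; _+_; _*_; _∸_; _^_)
open import Data.List using (List; length; drop; take)
open import Data.List.Properties using (≡-dec)
open import Relation.Binary.PropositionalEquality using (_≡_; refl)
open import Relation.Nullary using (Dec; yes; no)

data Coin : Set where
  H T : Coin

_≟c_ : (x y : Coin) → Dec (x ≡ y)
H ≟c H = yes refl
H ≟c T = no λ ()
T ≟c H = no λ ()
T ≟c T = yes refl

eqStr? : (u v : List Coin) → Dec (u ≡ v)
eqStr? = ≡-dec _≟c_

overlapBit : (A B : List Coin) → ℕ → ℕ
overlapBit A B k with eqStr? (drop (length A ∸ k) A) (take k B)
... | yes _ = 1
... | no  _ = 0

-- Σ_{k=1}^{K} overlapBit A B k * 2^(k-1)
-- (the overlap of length k = n-i+1 corresponds to δ_i with weight 2^(n-i) = 2^(k-1))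
conwaySum : (A B : List Coin) → ℕ → ℕ
conwaySum A B zero = 0
conwaySum A B (suc k) = overlapBit A B (suc k) * 2 ^ k + conwaySum A B k

-- Conway number C(A,B), intended for strings of equal length n = length A
conway : (A B : List Coin) → ℕ
conway A B = conwaySum A B (length A)

autocorr : List Coin → ℕ
autocorr A = conway A A

open import Data.Product using (∃)

LastBitsOne : ℕ → ℕ → Set
LastBitsOne m x = ∃ λ q → x ≡ q * 2 ^ m + 1

{-# OPTIONS --safe #-}
-- The hypothesis says that among the overlaps of length at most m only the one of length 1
-- occurs.  An overlap of length k in a string of length n is a period n ∸ k, and periods are
-- closed under addition.  A period p < m would have a multiple j p with n ∸ j p ∈ [2, m],
-- i.e. an absent overlap; so there is no overlap of length k with n ∸ m < k < n.  For n = 2m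
-- only the overlaps of length 1 and n remain, for n = 2m+1 possibly also m+1; for n = 2m+2 an
-- overlap of length m+2 is excluded separately, since the period m gives the period 2m.
module Submission where

open import Defs
open import Data.Nat using (ℕ; zero; suc; _+_; _*_; _^_; _∸_; _≤_; _<_; _⊓_; z≤n; s≤s; s≤s⁻¹; NonZero; >-nonZero)
open import Data.Nat.Properties
open import Data.Nat.DivMod using (_/_; _%_; m≡m%n+[m/n]*n; m%n<n; m/n*n≤m; [m+kn]%n≡m%n; m<n⇒m%n≡m)
open import Data.List using (List; []; _∷_; length; drop; take)
open import Data.List.Properties using (take-all; take-take; drop-drop; drop-[]; take-[])
open import Data.Product using (_×_; _,_)
open import Data.Sum using (_⊎_; inj₁; inj₂)
open import Data.Empty using (⊥; ⊥-elim)
open import Relation.Nullary using (yes; no)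
open import Relation.Binary.PropositionalEquality
open import Data.Nat.Tactic.RingSolver using (solve-∀)

module _ {a} {X : Set a} where

  drop-take : ∀ p k (xs : List X) → drop p (take k xs) ≡ take (k ∸ p) (drop p xs)
  drop-take zero    k       xs       = refl
  drop-take (suc p) zero    xs       = drop-[] (suc p)
  drop-take (suc p) (suc k) []       = sym (take-[] (k ∸ p))
  drop-take (suc p) (suc k) (x ∷ xs) = drop-take p k xs

  HasPeriod : List X → ℕ → Set a
  HasPeriod xs p = drop p xs ≡ take (length xs ∸ p) xs

  hasPeriod-0 : (xs : List X) → HasPeriod xs 0
  hasPeriod-0 xs = sym (take-all (length xs) xs ≤-refl)

  hasPeriod-+ : ∀ {xs p q} → HasPeriod xs p → HasPeriod xs q → HasPeriod xs (p + q)
  hasPeriod-+ {xs} {p} {q} P Q = begin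
    drop (p + q) xs                       ≡⟨ drop-drop p q xs ⟨
    drop q (drop p xs)                    ≡⟨ cong (drop q) P ⟩
    drop q (take (n ∸ p) xs)              ≡⟨ drop-take q (n ∸ p) xs ⟩
    take (n ∸ p ∸ q) (drop q xs)          ≡⟨ cong (take (n ∸ p ∸ q)) Q ⟩
    take (n ∸ p ∸ q) (take (n ∸ q) xs)    ≡⟨ take-take (n ∸ p ∸ q) (n ∸ q) xs ⟩
    take ((n ∸ p ∸ q) ⊓ (n ∸ q)) xs       ≡⟨ cong (λ i → take i xs) shorter ⟩
    take (n ∸ (p + q)) xs                 ∎
    where
    open ≡-Reasoning
    n = length xs
    shorter : (n ∸ p ∸ q) ⊓ (n ∸ q) ≡ n ∸ (p + q)
    shorter rewrite ∸-+-assoc n p q = m≤n⇒m⊓n≡m (∸-monoʳ-≤ n (m≤n+m q p))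

  hasPeriod-* : ∀ {xs p} → HasPeriod xs p → ∀ j → HasPeriod xs (j * p)
  hasPeriod-* {xs} P zero    = hasPeriod-0 xs
  hasPeriod-* {xs} {p} P (suc j) = hasPeriod-+ {xs} {p} {j * p} P (hasPeriod-* P j)

BitsVanish : List Coin → List Coin → ℕ → ℕ → Set
BitsVanish A B a b = ∀ k → a < k → k ≤ b → overlapBit A B k ≡ 0

lastBitsOne⇒%≡1 : ∀ {m x} → 1 ≤ m → LastBitsOne m x → _%_ x (2 ^ m) {{m^n≢0 2 m}} ≡ 1
lastBitsOne⇒%≡1 {m} 1≤m (q , refl) = begin
  (q * 2 ^ m + 1) % 2 ^ m  ≡⟨ cong (_% 2 ^ m) (+-comm (q * 2 ^ m) 1) ⟩
  (1 + q * 2 ^ m) % 2 ^ m  ≡⟨ [m+kn]%n≡m%n 1 q (2 ^ m) ⟩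
  1 % 2 ^ m                ≡⟨ m<n⇒m%n≡m (^-monoʳ-< 2 (s≤s (s≤s z≤n)) 1≤m) ⟩
  1                        ∎
  where
  open ≡-Reasoning
  instance
    _ : NonZero (2 ^ m)
    _ = m^n≢0 2 m

module _ (A B : List Coin) where

  overlapBit-cases : ∀ k → overlapBit A B k ≡ 0 ⊎ overlapBit A B k ≡ 1
  overlapBit-cases k with eqStr? (drop (length A ∸ k) A) (take k B)
  ... | yes _ = inj₂ refl
  ... | no  _ = inj₁ refl

  overlapBit≡1⇒overlap : ∀ {k} → overlapBit A B k ≡ 1 → drop (length A ∸ k) A ≡ take k B
  overlapBit≡1⇒overlap {k} b≡1 with eqStr? (drop (length A ∸ k) A) (take k B)
  overlapBit≡1⇒overlap     _   | yes same = same
  overlapBit≡1⇒overlap     ()  | no _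

  overlap⇒overlapBit≡1 : ∀ {k} → drop (length A ∸ k) A ≡ take k B → overlapBit A B k ≡ 1
  overlap⇒overlapBit≡1 {k} same with eqStr? (drop (length A ∸ k) A) (take k B)
  ... | yes _      = refl
  ... | no differ = ⊥-elim (differ same)

  overlapBit≤1 : ∀ k → overlapBit A B k ≤ 1
  overlapBit≤1 k with overlapBit-cases k
  ... | inj₁ b≡0 = ≤-trans (≤-reflexive b≡0) z≤n
  ... | inj₂ b≡1 = ≤-reflexive b≡1

  conwaySum<2^ : ∀ k → conwaySum A B k < 2 ^ k
  conwaySum<2^ zero    = s≤s z≤n
  conwaySum<2^ (suc k) = begin-strict
    overlapBit A B (suc k) * 2 ^ k + conwaySum A B k  <⟨ +-mono-≤-< top (conwaySum<2^ k) ⟩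
    2 ^ k + 2 ^ k                                       ≡⟨ cong (2 ^ k +_) (+-identityʳ (2 ^ k)) ⟨
    2 ^ suc k                                           ∎
    where
    open ≤-Reasoning
    top : overlapBit A B (suc k) * 2 ^ k ≤ 2 ^ k
    top = ≤-trans (*-monoˡ-≤ (2 ^ k) (overlapBit≤1 (suc k))) (≤-reflexive (*-identityˡ (2 ^ k)))

  conwaySum-suc-cases : ∀ k → conwaySum A B (suc k) ≡ conwaySum A B k
                            ⊎ conwaySum A B (suc k) ≡ 2 ^ k + conwaySum A B k
  conwaySum-suc-cases k with overlapBit-cases (suc k)
  ... | inj₁ b≡0 = inj₁ (cong (λ b → b * 2 ^ k + conwaySum A B k) b≡0)
  ... | inj₂ b≡1 = inj₂ (trans (cong (λ b → b * 2 ^ k + conwaySum A B k) b≡1)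
                               (cong (_+ conwaySum A B k) (*-identityˡ (2 ^ k))))

  conwaySum-mod : ∀ m t → _%_ (conwaySum A B (t + m)) (2 ^ m) {{m^n≢0 2 m}} ≡ conwaySum A B m
  conwaySum-mod m zero    = m<n⇒m%n≡m {{m^n≢0 2 m}} (conwaySum<2^ m)
  conwaySum-mod m (suc t) = begin
    (b * 2 ^ (t + m) + cs (t + m)) % 2 ^ m   ≡⟨ cong (_% 2 ^ m) (+-comm (b * 2 ^ (t + m)) (cs (t + m))) ⟩
    (cs (t + m) + b * 2 ^ (t + m)) % 2 ^ m   ≡⟨ cong (λ x → (cs (t + m) + x) % 2 ^ m) split ⟩
    (cs (t + m) + b * 2 ^ t * 2 ^ m) % 2 ^ m ≡⟨ [m+kn]%n≡m%n (cs (t + m)) (b * 2 ^ t) (2 ^ m) ⟩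
    cs (t + m) % 2 ^ m                       ≡⟨ conwaySum-mod m t ⟩
    cs m                                     ∎
    where
    open ≡-Reasoning
    instance
      _ : NonZero (2 ^ m)
      _ = m^n≢0 2 m
    cs = conwaySum A B
    b = overlapBit A B (suc (t + m))
    split : b * 2 ^ (t + m) ≡ b * 2 ^ t * 2 ^ m
    split = trans (cong (b *_) (^-distribˡ-+-* 2 t m)) (sym (*-assoc b (2 ^ t) (2 ^ m)))

  conwaySum-low : ∀ {m k} → 1 ≤ m → m ≤ k → LastBitsOne m (conwaySum A B k) → conwaySum A B m ≡ 1
  conwaySum-low {m} {k} 1≤m m≤k L = begin
    conwaySum A B m                   ≡⟨ conwaySum-mod m (k ∸ m) ⟨
    conwaySum A B (k ∸ m + m) % 2 ^ m ≡⟨ cong (λ i → conwaySum A B i % 2 ^ m) (m∸n+n≡m m≤k) ⟩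
    conwaySum A B k % 2 ^ m           ≡⟨ lastBitsOne⇒%≡1 1≤m L ⟩
    1                                 ∎
    where
    open ≡-Reasoning
    instance
      _ : NonZero (2 ^ m)
      _ = m^n≢0 2 m

  weight≤conwaySum : ∀ {j k} → j < k → overlapBit A B (suc j) * 2 ^ j ≤ conwaySum A B k
  weight≤conwaySum {j} {suc k} j<1+k with m≤n⇒m<n∨m≡n (s≤s⁻¹ j<1+k)
  ... | inj₂ refl = m≤m+n _ (conwaySum A B k)
  ... | inj₁ j<k  = ≤-trans (weight≤conwaySum j<k) (m≤n+m (conwaySum A B k) _)

  conwaySum≡1⇒vanish : ∀ {k} → conwaySum A B k ≡ 1 → BitsVanish A B 1 k
  conwaySum≡1⇒vanish {k} cs≡1 (suc j) (s≤s 1≤j) j<k with overlapBit-cases (suc j)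
  ... | inj₁ b≡0 = b≡0
  ... | inj₂ b≡1 = ⊥-elim (<-irrefl refl (begin
    2                              ≤⟨ ^-monoʳ-≤ 2 1≤j ⟩
    2 ^ j                          ≡⟨ *-identityˡ (2 ^ j) ⟨
    1 * 2 ^ j                      ≡⟨ cong (_* 2 ^ j) b≡1 ⟨
    overlapBit A B (suc j) * 2 ^ j ≤⟨ weight≤conwaySum j<k ⟩
    conwaySum A B k                ≡⟨ cs≡1 ⟩
    1                              ∎))
    where open ≤-Reasoning

  conwaySum-flat : ∀ {a b} → a ≤ b → BitsVanish A B a b → conwaySum A B b ≡ conwaySum A B a
  conwaySum-flat {a} {zero}  z≤n   _ = refl
  conwaySum-flat {a} {suc b} a≤1+b Z with m≤n⇒m<n∨m≡n a≤1+b
  ... | inj₂ refl  = refl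
  ... | inj₁ a<1+b = begin
    overlapBit A B (suc b) * 2 ^ b + conwaySum A B b ≡⟨ cong (λ x → x * 2 ^ b + conwaySum A B b) (Z (suc b) a<1+b ≤-refl) ⟩
    conwaySum A B b                                  ≡⟨ conwaySum-flat (s≤s⁻¹ a<1+b) (λ k a<k k≤b → Z k a<k (m≤n⇒m≤1+n k≤b)) ⟩
    conwaySum A B a                                  ∎
    where open ≡-Reasoning

  bitsVanish-extend : ∀ {a b} → overlapBit A B (suc a) ≡ 0 → BitsVanish A B (suc a) b → BitsVanish A B a b
  bitsVanish-extend b≡0 Z k a<k k≤b with m≤n⇒m<n∨m≡n a<k
  ... | inj₁ 1+a<k = Z k 1+a<k k≤b
  ... | inj₂ refl  = b≡0

module _ (A : List Coin) where

  overlapBit≡1⇒hasPeriod : ∀ {k p} → overlapBit A A k ≡ 1 → k + p ≡ length A → HasPeriod A p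
  overlapBit≡1⇒hasPeriod {k} {p} b≡1 k+p≡n =
    subst₂ (λ d t → drop d A ≡ take t A) n∸k≡p k≡n∸p (overlapBit≡1⇒overlap A A b≡1)
    where
    n∸k≡p : length A ∸ k ≡ p
    n∸k≡p = trans (cong (_∸ k) (sym k+p≡n)) (m+n∸m≡n k p)
    k≡n∸p : k ≡ length A ∸ p
    k≡n∸p = sym (trans (cong (_∸ p) (sym k+p≡n)) (m+n∸n≡m k p))

  hasPeriod⇒overlapBit≡1 : ∀ {p} → HasPeriod A p → p ≤ length A → overlapBit A A (length A ∸ p) ≡ 1
  hasPeriod⇒overlapBit≡1 P p≤n = overlap⇒overlapBit≡1 A A (trans (cong (λ d → drop d A) (m∸[m∸n]≡n p≤n)) P)

  autocorr-top : ∀ {N} → length A ≡ suc N → autocorr A ≡ 2 ^ N + conwaySum A A N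
  autocorr-top {N} len = begin
    autocorr A                                       ≡⟨ cong (conwaySum A A) len ⟩
    overlapBit A A (suc N) * 2 ^ N + conwaySum A A N ≡⟨ cong (λ b → b * 2 ^ N + conwaySum A A N) full ⟩
    1 * 2 ^ N + conwaySum A A N                      ≡⟨ cong (_+ conwaySum A A N) (*-identityˡ (2 ^ N)) ⟩
    2 ^ N + conwaySum A A N                          ∎
    where
    open ≡-Reasoning
    full : overlapBit A A (suc N) ≡ 1
    full = subst (λ k → overlapBit A A k ≡ 1) len (hasPeriod⇒overlapBit≡1 (hasPeriod-0 A) z≤n)

  vanish⇒¬hasPeriod : ∀ {m q} → BitsVanish A A 1 m → HasPeriod A q →
                      q + 2 ≤ length A → length A ≤ q + m → ⊥
  vanish⇒¬hasPeriod {m} {q} Z P q+2≤n n≤q+m =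
    0≢1+n (trans (sym (Z (n ∸ q) 2≤n∸q n∸q≤m)) (hasPeriod⇒overlapBit≡1 P q≤n))
    where
    n = length A
    q≤n : q ≤ n
    q≤n = ≤-trans (m≤m+n q 2) q+2≤n
    2≤n∸q : 2 ≤ n ∸ q
    2≤n∸q = subst (_≤ n ∸ q) (m+n∸m≡n q 2) (∸-monoˡ-≤ q q+2≤n)
    n∸q≤m : n ∸ q ≤ m
    n∸q≤m = m≤n+o⇒m∸n≤o n q n≤q+m

  -- The multiple of the period n ∸ k closest below n ∸ 2 leaves an overlap of length in [2, m].
  overlapBit-vanish : ∀ {m k} → BitsVanish A A 1 m → 0 < k → k < length A → length A < k + m →
                      overlapBit A A k ≡ 0
  overlapBit-vanish {m} {k} Z 0<k k<n n<k+m with overlapBit-cases A A k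
  ... | inj₁ b≡0 = b≡0
  ... | inj₂ b≡1 = ⊥-elim (vanish⇒¬hasPeriod Z (hasPeriod-* P j) lower upper)
    where
    n = length A
    p = n ∸ k
    instance
      _ : NonZero p
      _ = >-nonZero (m<n⇒0<n∸m k<n)
    k+p≡n : k + p ≡ n
    k+p≡n = m+[n∸m]≡n (<⇒≤ k<n)
    P : HasPeriod A p
    P = overlapBit≡1⇒hasPeriod b≡1 k+p≡n
    j = (n ∸ 2) / p
    r = (n ∸ 2) % p
    2≤n : 2 ≤ n
    2≤n = ≤-trans (s≤s 0<k) k<n
    lower : j * p + 2 ≤ n
    lower = ≤-trans (+-monoˡ-≤ 2 (m/n*n≤m (n ∸ 2) p)) (≤-reflexive (m∸n+n≡m 2≤n))
    p<m : p < m
    p<m = +-cancelˡ-< k p m (subst (_< k + m) (sym k+p≡n) n<k+m)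
    r+2≤m : r + 2 ≤ m
    r+2≤m = ≤-trans (≤-reflexive (+-comm r 2)) (≤-trans (s≤s (m%n<n (n ∸ 2) p)) p<m)
    upper : n ≤ j * p + m
    upper = begin
      n                 ≡⟨ m∸n+n≡m 2≤n ⟨
      n ∸ 2 + 2         ≡⟨ cong (_+ 2) (m≡m%n+[m/n]*n (n ∸ 2) p) ⟩
      r + j * p + 2     ≡⟨ cong (_+ 2) (+-comm r (j * p)) ⟩
      j * p + r + 2     ≡⟨ +-assoc (j * p) r 2 ⟩
      j * p + (r + 2)   ≤⟨ +-monoʳ-≤ (j * p) r+2≤m ⟩
      j * p + m         ∎
      where open ≤-Reasoning

  vanish-above : ∀ {m s N} → BitsVanish A A 1 m → length A ≡ suc N → length A ≤ s + m → BitsVanish A A s N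
  vanish-above {m} Z len n≤s+m k s<k k≤N =
    overlapBit-vanish Z (≤-trans (s≤s z≤n) s<k) (subst (k <_) (sym len) (s≤s k≤N))
                        (≤-<-trans n≤s+m (+-monoˡ-< m s<k))

  autocorr≡2^N+conwaySum : ∀ {N s} → length A ≡ suc N → s ≤ N → BitsVanish A A s N →
                           autocorr A ≡ 2 ^ N + conwaySum A A s
  autocorr≡2^N+conwaySum {N} len s≤N Z = trans (autocorr-top len) (cong (2 ^ N +_) (conwaySum-flat A A s≤N Z))

  autocorr-suc-cases : ∀ {m N} → conwaySum A A m ≡ 1 → autocorr A ≡ 2 ^ N + conwaySum A A (suc m) →
                       autocorr A ≡ 2 ^ N + 1 ⊎ autocorr A ≡ 2 ^ N + 2 ^ m + 1
  autocorr-suc-cases {m} {N} low tail with conwaySum-suc-cases A A m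
  ... | inj₁ same = inj₁ (trans tail (cong (2 ^ N +_) (trans same low)))
  ... | inj₂ more = inj₂ (begin
    autocorr A                       ≡⟨ tail ⟩
    2 ^ N + conwaySum A A (suc m)    ≡⟨ cong (2 ^ N +_) (trans more (cong (2 ^ m +_) low)) ⟩
    2 ^ N + (2 ^ m + 1)              ≡⟨ +-assoc (2 ^ N) (2 ^ m) 1 ⟨
    2 ^ N + 2 ^ m + 1                ∎)
    where open ≡-Reasoning

2*m+1≡1+m+m : ∀ m → 2 * m + 1 ≡ suc m + m
2*m+1≡1+m+m = solve-∀

2*m+2≡2+m+m : ∀ m → 2 * m + 2 ≡ suc (suc m) + m
2*m+2≡2+m+m = solve-∀

m≤2*m : ∀ m → m ≤ 2 * m
m≤2*m m = m≤m+n m (m + 0)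

autocorr-2m : ∀ {m} → 1 ≤ m → (A : List Coin) → length A ≡ 2 * m → LastBitsOne m (autocorr A) →
              autocorr A ≡ 2 ^ (2 * m ∸ 1) + 1
-- As m = suc m′, the type of len is definitionally length A ≡ suc (2 * m ∸ 1).
autocorr-2m {m@(suc m′)} _ A len L = begin
  autocorr A                        ≡⟨ autocorr≡2^N+conwaySum A len m≤2*m∸1 (vanish-above A gap len n≤m+m) ⟩
  2 ^ (2 * m ∸ 1) + conwaySum A A m ≡⟨ cong (2 ^ (2 * m ∸ 1) +_) low ⟩
  2 ^ (2 * m ∸ 1) + 1               ∎
  where
  open ≡-Reasoning
  low : conwaySum A A m ≡ 1
  low = conwaySum-low A A (s≤s z≤n) (subst (m ≤_) (sym len) (m≤2*m m)) L
  gap : BitsVanish A A 1 m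
  gap = conwaySum≡1⇒vanish A A low
  n≤m+m : length A ≤ m + m
  n≤m+m = ≤-reflexive (trans len (cong (m +_) (+-identityʳ m)))
  m≤2*m∸1 : m ≤ 2 * m ∸ 1
  m≤2*m∸1 = ≤-trans (m≤n+m m m′) (≤-reflexive (cong (λ x → m′ + suc x) (sym (+-identityʳ m′))))

autocorr-2m+1 : ∀ {m} → 1 ≤ m → (A : List Coin) → length A ≡ 2 * m + 1 → LastBitsOne m (autocorr A) →
                autocorr A ≡ 2 ^ (2 * m) + 1 ⊎ autocorr A ≡ 2 ^ (2 * m) + 2 ^ m + 1
autocorr-2m+1 {m} 1≤m A len L = autocorr-suc-cases A {m} {2 * m} low
  (autocorr≡2^N+conwaySum A len′ 1+m≤2*m (vanish-above A gap len′ (≤-reflexive (trans len (2*m+1≡1+m+m m)))))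
  where
  len′ : length A ≡ suc (2 * m)
  len′ = trans len (+-comm (2 * m) 1)
  low : conwaySum A A m ≡ 1
  low = conwaySum-low A A 1≤m (subst (m ≤_) (sym len) (≤-trans (m≤2*m m) (m≤m+n (2 * m) 1))) L
  gap : BitsVanish A A 1 m
  gap = conwaySum≡1⇒vanish A A low
  1+m≤2*m : suc m ≤ 2 * m
  1+m≤2*m = ≤-trans (+-monoˡ-≤ m 1≤m) (≤-reflexive (cong (m +_) (sym (+-identityʳ m))))

autocorr-2m+2 : ∀ {m} → 2 ≤ m → (A : List Coin) → length A ≡ 2 * m + 2 → LastBitsOne m (autocorr A) →
                autocorr A ≡ 2 ^ (2 * m + 1) + 1 ⊎ autocorr A ≡ 2 ^ (2 * m + 1) + 2 ^ m + 1
autocorr-2m+2 {m} 2≤m A len L = autocorr-suc-cases A {m} {2 * m + 1} low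
  (autocorr≡2^N+conwaySum A len′ 1+m≤2*m+1 (bitsVanish-extend A A no-overlap-m+2 (vanish-above A gap len′ (≤-reflexive n≡2+m+m))))
  where
  len′ : length A ≡ suc (2 * m + 1)
  len′ = trans len (+-suc (2 * m) 1)
  n≡2+m+m : length A ≡ suc (suc m) + m
  n≡2+m+m = trans len (2*m+2≡2+m+m m)
  low : conwaySum A A m ≡ 1
  low = conwaySum-low A A (≤-trans (s≤s z≤n) 2≤m) (subst (m ≤_) (sym len) (≤-trans (m≤2*m m) (m≤m+n (2 * m) 2))) L
  gap : BitsVanish A A 1 m
  gap = conwaySum≡1⇒vanish A A low
  1+m≤2*m+1 : suc m ≤ 2 * m + 1
  1+m≤2*m+1 = ≤-trans (≤-reflexive (+-comm 1 m)) (+-monoˡ-≤ 1 (m≤2*m m))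
  no-overlap-m+2 : overlapBit A A (suc (suc m)) ≡ 0
  no-overlap-m+2 with overlapBit-cases A A (suc (suc m))
  ... | inj₁ b≡0 = b≡0
  ... | inj₂ b≡1 = ⊥-elim (vanish⇒¬hasPeriod A gap (hasPeriod-* {xs = A} {p = m} period-m 2) (≤-reflexive (sym len))
                                            (≤-trans (≤-reflexive len) (+-monoʳ-≤ (2 * m) 2≤m)))
    where
    period-m : HasPeriod A m
    period-m = overlapBit≡1⇒hasPeriod A b≡1 (sym n≡2+m+m)

lemma2p5 : (m : ℕ) → 2 ≤ m →
    ((A : List Coin) → length A ≡ 2 * m → LastBitsOne m (autocorr A) →
        autocorr A ≡ 2 ^ (2 * m ∸ 1) + 1) ×
    ((A : List Coin) → length A ≡ 2 * m + 1 → LastBitsOne m (autocorr A) →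
        autocorr A ≡ 2 ^ (2 * m) + 1 ⊎ autocorr A ≡ 2 ^ (2 * m) + 2 ^ m + 1) ×
    ((A : List Coin) → length A ≡ 2 * m + 2 → LastBitsOne m (autocorr A) →
        autocorr A ≡ 2 ^ (2 * m + 1) + 1 ⊎ autocorr A ≡ 2 ^ (2 * m + 1) + 2 ^ m + 1)
lemma2p5 m 2≤m = autocorr-2m 1≤m , autocorr-2m+1 1≤m , autocorr-2m+2 2≤m
  where
  1≤m : 1 ≤ m
  1≤m = ≤-trans (s≤s z≤n) 2≤m
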